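{- Let $M$ be a set and $\bot$ a symbol not in $M$. Then $(\mathcal P_\bot(M), \leq)$ is a chain-complete partially ordered set. Its minimum is the class of $\{\bot\}$, and its maximal elements are the class of $M$ and the final sets. The union of $\sim$-equivalence classes is well-defined by taking the union of representatives, and for any chain $F \subseteq \mathcal P_\bot(M)$: if $\bot \in A$ for all $A \in F$, then $\sup F = \bigcup_{A \in F} A$; and if there is some $Z \in F$ with $\bot \notin Z$, then $\sup F = Z$, and in this case such a $Z$ is unique.
   Context: For a set $M$ and a fresh symbol $\bot \notin M$ (representing non-termination), define $\mathcal P_\bot(M) := \mathcal P(M \cup \{\bot\}) / {\sim}$, where for $A, B \subseteq M \cup \{\bot\}$ we set $A \sim B$ iff $A = B$, or $A$ is infinite and $A \oplus B = \{\bot\}$ (here $A \oplus B = (A \cup B) \setminus (A \cap B)$ is the symmetric difference). Thus an infinite set is identified with the same set with $\bot$ added or removed. Equivalence classes are referred to through representatives, taking infinite sets containing $\bot$ as the representatives of their classes; accordingly, "$\bot \in A$" means that $A$ contains $\bot$ or $A$ is infinite. The order on $\mathcal P_\bot(M)$ is: $A \leq B$ iff $A = B$, or ($\bot \in A$ and $A \setminus \{\bot\} \subseteq B$). A set $A$ with $\bot \notin A$ is called final. A chain-complete partially ordered set is a partial order in which every chain has a supremum. -}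

module Defs where

open import Data.Bool using (Bool; true; false)
open import Data.Maybe using (Maybe; just; nothing)
open import Data.List using (List)
open import Data.List.Membership.Propositional using (_∈_)
open import Data.Product using (Σ; ∃; _×_; _,_)
open import Data.Sum using (_⊎_)
open import Relation.Nullary using (¬_)
open import Relation.Binary.PropositionalEquality using (_≡_)
open import Function.Bundles using (_⇔_)

-- M ∪ {⊥} is modelled as Maybe M, with  nothing  playing the role of ⊥.
-- A subset of M ∪ {⊥} is a Bool-valued characteristic function
-- (all subsets, since excluded middle is assumed in the theorem).
Subset : Set → Set
Subset M = Maybe M → Bool

module _ {M : Set} where

  infix 4 _∈ˢ_ _∼_ _≤⊥_

  _∈ˢ_ : Maybe M → Subset M → Set
  x ∈ˢ A = A x ≡ true

  Finite : Subset M → Set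
  Finite A = ∃ λ (xs : List (Maybe M)) → ∀ x → x ∈ˢ A → x ∈ xs

  Infinite : Subset M → Set
  Infinite A = ¬ Finite A

  SameSet : Subset M → Subset M → Set
  SameSet A B = ∀ x → A x ≡ B x

  SymDiffIsBot : Subset M → Subset M → Set
  SymDiffIsBot A B =
    ∀ x → (((x ∈ˢ A) × ¬ (x ∈ˢ B)) ⊎ ((x ∈ˢ B) × ¬ (x ∈ˢ A))) ⇔ (x ≡ nothing)

  _∼_ : Subset M → Subset M → Set
  A ∼ B = SameSet A B ⊎ (Infinite A × SymDiffIsBot A B)

  Bot∈ : Subset M → Set
  Bot∈ A = (nothing ∈ˢ A) ⊎ Infinite A

  Final : Subset M → Set
  Final A = ¬ Bot∈ A

  _≤⊥_ : Subset M → Subset M → Set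
  A ≤⊥ B = (A ∼ B) ⊎ (Bot∈ A × (∀ m → just m ∈ˢ A → just m ∈ˢ B))

  BotSet : Subset M
  BotSet nothing = true
  BotSet (just _) = false

  MSet : Subset M
  MSet nothing = false
  MSet (just _) = true

  Maximal : Subset M → Set
  Maximal A = ∀ B → A ≤⊥ B → A ∼ B

  -- A family F ⊆ P⊥(M) is given by a predicate on representatives.
  IsChain : (Subset M → Set) → Set
  IsChain F = ∀ A B → F A → F B → (A ≤⊥ B) ⊎ (B ≤⊥ A)

  IsSup : (Subset M → Set) → Subset M → Set
  IsSup F S = (∀ A → F A → A ≤⊥ S) × (∀ U → (∀ A → F A → A ≤⊥ U) → S ≤⊥ U)

  ChainComplete : Set₁
  ChainComplete = ∀ (F : Subset M → Set) → IsChain F → ∃ λ S → IsSup F S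

  IsUnion : (Subset M → Set) → Subset M → Set
  IsUnion F U = ∀ x → (x ∈ˢ U) ⇔ (∃ λ A → F A × (x ∈ˢ A))

  SameClasses : (Subset M → Set) → (Subset M → Set) → Set
  SameClasses F G = (∀ A → F A → ∃ λ B → G B × (A ∼ B))
                  × (∀ B → G B → ∃ λ A → F A × (A ∼ B))

  UnionWellDefined : Set₁
  UnionWellDefined =
    (∀ (F : Subset M → Set) → ∃ λ U → IsUnion F U)
    × (∀ (F G : Subset M → Set) (U V : Subset M) →
         SameClasses F G → IsUnion F U → IsUnion G V → U ∼ V)

-- Two representatives are equivalent iff they agree on M and, if they differ
-- at ⊥, are infinite. Hence ≤ is inclusion on M, with ⊥ ∈ A saying that A may
-- still grow. A final set cannot grow, so it is the maximum of any chain
-- containing it; a chain all of whose members contain ⊥ is bounded by its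
-- union, which again contains ⊥ (or is infinite) and so lies below every upper
-- bound. Excluded middle is needed only to form unions and to decide whether a
-- chain has a final member.
module Submission where

open import Defs
open import Level using (0ℓ)
open import Axiom.ExcludedMiddle using (ExcludedMiddle)
open import Data.Bool using (Bool; true; false)
open import Data.Bool.Properties using (_≟_; ⇔→≡)
open import Data.List using (_∷_)
open import Data.List.Relation.Unary.Any using (here; there)
open import Data.Maybe using (just; nothing)
open import Data.Product using (∃; _×_; _,_)
open import Data.Sum using (_⊎_; inj₁; inj₂)
open import Function.Bundles using (_⇔_; Equivalence; mk⇔)
open import Relation.Binary.Structures using (IsEquivalence; IsPartialOrder)
open import Relation.Nullary using (yes; no; does; contradiction)
open import Relation.Binary.PropositionalEquality using (_≡_; _≢_; refl; sym; trans)

≢⇒exactly-one-true : ∀ {a b : Bool} → a ≢ b →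
                     (a ≡ true × b ≢ true) ⊎ (b ≡ true × a ≢ true)
≢⇒exactly-one-true {true}  {false} _   = inj₁ (refl , λ ())
≢⇒exactly-one-true {false} {true}  _   = inj₂ (refl , λ ())
≢⇒exactly-one-true {true}  {true}  a≢b = contradiction refl a≢b
≢⇒exactly-one-true {false} {false} a≢b = contradiction refl a≢b

module _ {M : Set} where

  infix 4 _⊆ᴹ_ _≗ᴹ_

  _⊆ᴹ_ : Subset M → Subset M → Set
  A ⊆ᴹ B = ∀ m → just m ∈ˢ A → just m ∈ˢ B

  _≗ᴹ_ : Subset M → Subset M → Set
  A ≗ᴹ B = ∀ m → A (just m) ≡ B (just m)

  private variable A B C U V Z : Subset M

  ≗ᴹ⇒⊆ᴹ : A ≗ᴹ B → A ⊆ᴹ B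
  ≗ᴹ⇒⊆ᴹ A≗B m a = trans (sym (A≗B m)) a

  ≗ᴹ-sym : A ≗ᴹ B → B ≗ᴹ A
  ≗ᴹ-sym A≗B m = sym (A≗B m)

  ⊆ᴹ-antisym : A ⊆ᴹ B → B ⊆ᴹ A → A ≗ᴹ B
  ⊆ᴹ-antisym A⊆B B⊆A m = ⇔→≡ (mk⇔ (A⊆B m) (B⊆A m))

  -- Finiteness ignores ⊥, because ⊥ can always be added to the witnessing list.
  finite-anti-⊆ᴹ : A ⊆ᴹ B → Finite B → Finite A
  finite-anti-⊆ᴹ {A} A⊆B (xs , B⊆xs) = nothing ∷ xs , A⊆⊥∷xs
    where
    A⊆⊥∷xs : ∀ x → x ∈ˢ A → _
    A⊆⊥∷xs nothing  _ = here refl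
    A⊆⊥∷xs (just m) a = there (B⊆xs (just m) (A⊆B m a))

  infinite-mono-⊆ᴹ : A ⊆ᴹ B → Infinite A → Infinite B
  infinite-mono-⊆ᴹ A⊆B infA finB = infA (finite-anti-⊆ᴹ A⊆B finB)

  symDiffIsBot⇒≗ᴹ : SymDiffIsBot A B → A ≗ᴹ B
  symDiffIsBot⇒≗ᴹ {A} {B} A⊕B m with A (just m) ≟ B (just m)
  ... | yes eq = eq
  ... | no neq with Equivalence.to (A⊕B (just m)) (≢⇒exactly-one-true neq)
  ...   | ()

  ≗ᴹ⇒symDiffIsBot : A ≗ᴹ B → A nothing ≢ B nothing → SymDiffIsBot A B
  ≗ᴹ⇒symDiffIsBot         A≗B ⊥≢ nothing  = mk⇔ (λ _ → refl) (λ _ → ≢⇒exactly-one-true ⊥≢)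
  ≗ᴹ⇒symDiffIsBot {A} {B} A≗B ⊥≢ (just m) = mk⇔ differs (λ ())
    where
    differs : _ → just m ≡ nothing
    differs (inj₁ (a , b∉)) = contradiction (trans (sym (A≗B m)) a) b∉
    differs (inj₂ (b , a∉)) = contradiction (trans (A≗B m) b) a∉

  ∼⇒≗ᴹ : A ∼ B → A ≗ᴹ B
  ∼⇒≗ᴹ (inj₁ A≡B)       m = A≡B (just m)
  ∼⇒≗ᴹ (inj₂ (_ , A⊕B))   = symDiffIsBot⇒≗ᴹ A⊕B

  ∼⇒⊆ᴹ : A ∼ B → A ⊆ᴹ B
  ∼⇒⊆ᴹ {A} {B} A∼B = ≗ᴹ⇒⊆ᴹ {A} {B} (∼⇒≗ᴹ A∼B)

  ∼⇒⊇ᴹ : A ∼ B → B ⊆ᴹ A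
  ∼⇒⊇ᴹ {A} {B} A∼B = ≗ᴹ⇒⊆ᴹ {B} {A} (≗ᴹ-sym {A} {B} (∼⇒≗ᴹ A∼B))

  ∼-⊥-mismatch⇒infinite : A ∼ B → A nothing ≢ B nothing → Infinite A
  ∼-⊥-mismatch⇒infinite (inj₁ A≡B)      ⊥≢ = contradiction (A≡B nothing) ⊥≢
  ∼-⊥-mismatch⇒infinite (inj₂ (infA , _)) _ = infA

  ≗ᴹ⇒∼ : A ≗ᴹ B → (A nothing ≢ B nothing → Infinite A) → A ∼ B
  ≗ᴹ⇒∼ {A} {B} A≗B mismatch⇒inf with A nothing ≟ B nothing
  ... | yes ⊥≡ = inj₁ sameSet
    where
    sameSet : SameSet A B
    sameSet nothing  = ⊥≡
    sameSet (just m) = A≗B m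
  ... | no ⊥≢ = inj₂ (mismatch⇒inf ⊥≢ , ≗ᴹ⇒symDiffIsBot A≗B ⊥≢)

  ∼-refl : A ∼ A
  ∼-refl = inj₁ (λ _ → refl)

  ∼-sym : A ∼ B → B ∼ A
  ∼-sym {A} {B} A∼B = ≗ᴹ⇒∼ (≗ᴹ-sym {A} {B} (∼⇒≗ᴹ A∼B))
    (λ ⊥≢ → infinite-mono-⊆ᴹ (∼⇒⊆ᴹ A∼B) (∼-⊥-mismatch⇒infinite A∼B (λ eq → ⊥≢ (sym eq))))

  ∼-trans : A ∼ B → B ∼ C → A ∼ C
  ∼-trans {A} {B} {C} A∼B B∼C = ≗ᴹ⇒∼ (λ m → trans (∼⇒≗ᴹ A∼B m) (∼⇒≗ᴹ B∼C m)) infinite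
    where
    infinite : A nothing ≢ C nothing → Infinite A
    infinite A≢C with A nothing ≟ B nothing
    ... | no  A≢B = ∼-⊥-mismatch⇒infinite A∼B A≢B
    ... | yes A≡B = infinite-mono-⊆ᴹ (∼⇒⊇ᴹ A∼B)
                      (∼-⊥-mismatch⇒infinite B∼C (λ B≡C → A≢C (trans A≡B B≡C)))

  ∼-isEquivalence : IsEquivalence (_∼_ {M})
  ∼-isEquivalence = record { refl = ∼-refl ; sym = ∼-sym ; trans = ∼-trans }

  Bot∈-resp-∼ : A ∼ B → Bot∈ B → Bot∈ A
  Bot∈-resp-∼ A∼B (inj₂ infB) = inj₂ (infinite-mono-⊆ᴹ (∼⇒⊇ᴹ A∼B) infB)
  Bot∈-resp-∼ {A} {B} A∼B (inj₁ ⊥∈B) with A nothing ≟ B nothing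
  ... | yes ⊥≡ = inj₁ (trans ⊥≡ ⊥∈B)
  ... | no  ⊥≢ = inj₂ (∼-⊥-mismatch⇒infinite A∼B ⊥≢)

  ≤⊥⇒⊆ᴹ : A ≤⊥ B → A ⊆ᴹ B
  ≤⊥⇒⊆ᴹ (inj₁ A∼B)     = ∼⇒⊆ᴹ A∼B
  ≤⊥⇒⊆ᴹ (inj₂ (_ , A⊆B)) = A⊆B

  ≤⊥-trans : A ≤⊥ B → B ≤⊥ C → A ≤⊥ C
  ≤⊥-trans (inj₁ A∼B)         (inj₁ B∼C)         = inj₁ (∼-trans A∼B B∼C)
  ≤⊥-trans (inj₁ A∼B)         (inj₂ (⊥∈B , B⊆C)) =
    inj₂ (Bot∈-resp-∼ A∼B ⊥∈B , λ m a → B⊆C m (∼⇒⊆ᴹ A∼B m a))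
  ≤⊥-trans (inj₂ (⊥∈A , A⊆B)) B≤C                =
    inj₂ (⊥∈A , λ m a → ≤⊥⇒⊆ᴹ B≤C m (A⊆B m a))

  ≤⊥-antisym : A ≤⊥ B → B ≤⊥ A → A ∼ B
  ≤⊥-antisym (inj₁ A∼B) _          = A∼B
  ≤⊥-antisym (inj₂ _)   (inj₁ B∼A) = ∼-sym B∼A
  ≤⊥-antisym {A} {B} (inj₂ (⊥∈A , A⊆B)) (inj₂ (⊥∈B , B⊆A)) =
    ≗ᴹ⇒∼ (⊆ᴹ-antisym {A} {B} A⊆B B⊆A) (infinite ⊥∈A ⊥∈B)
    where
    infinite : Bot∈ A → Bot∈ B → A nothing ≢ B nothing → Infinite A
    infinite (inj₂ infA) _           _  = infA
    infinite (inj₁ a)    (inj₁ b)    ⊥≢ = contradiction (trans a (sym b)) ⊥≢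
    infinite (inj₁ _)    (inj₂ infB) _  = infinite-mono-⊆ᴹ B⊆A infB

  ≤⊥-isPartialOrder : IsPartialOrder (_∼_ {M}) _≤⊥_
  ≤⊥-isPartialOrder = record
    { isPreorder = record { isEquivalence = ∼-isEquivalence ; reflexive = inj₁ ; trans = ≤⊥-trans }
    ; antisym    = ≤⊥-antisym
    }

  BotSet-minimum : (A : Subset M) → BotSet ≤⊥ A
  BotSet-minimum A = inj₂ (inj₁ refl , λ m ())

  final⇒maximal : Final Z → Maximal Z
  final⇒maximal finZ _ (inj₁ Z∼A)       = Z∼A
  final⇒maximal finZ _ (inj₂ (⊥∈Z , _)) = contradiction ⊥∈Z finZ

  ∼MSet⇒maximal : Bot∈ A → A ∼ MSet → Maximal A
  ∼MSet⇒maximal _ _ _ (inj₁ A∼B) = A∼B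
  ∼MSet⇒maximal {A} ⊥∈A A∼M B (inj₂ (_ , A⊆B)) =
    ≗ᴹ⇒∼ (⊆ᴹ-antisym {A} {B} A⊆B (λ m _ → ∼⇒⊇ᴹ A∼M m refl)) (λ _ → infinite ⊥∈A)
    where
    infinite : Bot∈ A → Infinite A
    infinite (inj₂ infA) = infA
    infinite (inj₁ a)    = ∼-⊥-mismatch⇒infinite A∼M (λ eq → contradiction (trans (sym a) eq) λ ())

  module _ (F : Subset M → Set) (chain : IsChain F) where

    final-isSup : ∀ {Z} → F Z → Final Z → IsSup F Z
    final-isSup {Z} Z∈F finZ = upper , λ U upperU → upperU Z Z∈F
      where
      upper : ∀ A → F A → A ≤⊥ Z
      upper A A∈F with chain A Z A∈F Z∈F
      ... | inj₁ A≤Z = A≤Z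
      ... | inj₂ Z≤A = inj₁ (∼-sym (final⇒maximal finZ A Z≤A))

    final-unique : ∀ {Z} → F Z → Final Z → ∀ Z′ → F Z′ → Final Z′ → Z ∼ Z′
    final-unique {Z} Z∈F finZ Z′ Z′∈F finZ′ with chain Z Z′ Z∈F Z′∈F
    ... | inj₁ Z≤Z′ = final⇒maximal finZ Z′ Z≤Z′
    ... | inj₂ Z′≤Z = ∼-sym (final⇒maximal finZ′ Z Z′≤Z)

    union-isSup : (∃ λ A → F A) → (∀ A → F A → Bot∈ A) → ∀ U → IsUnion F U → IsSup F U
    union-isSup (A₀ , A₀∈F) allBot U U≡⋃F = upper , least
      where
      ⊆U : ∀ A → F A → ∀ x → x ∈ˢ A → x ∈ˢ U
      ⊆U A A∈F x a = Equivalence.from (U≡⋃F x) (A , A∈F , a)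

      upper : ∀ A → F A → A ≤⊥ U
      upper A A∈F = inj₂ (allBot A A∈F , λ m → ⊆U A A∈F (just m))

      ⊥∈U : Bot∈ U
      ⊥∈U with allBot A₀ A₀∈F
      ... | inj₁ ⊥∈A₀  = inj₁ (⊆U A₀ A₀∈F nothing ⊥∈A₀)
      ... | inj₂ infA₀ = inj₂ (infinite-mono-⊆ᴹ (λ m → ⊆U A₀ A₀∈F (just m)) infA₀)

      least : ∀ V → (∀ A → F A → A ≤⊥ V) → U ≤⊥ V
      least V upperV = inj₂ (⊥∈U , U⊆V)
        where
        U⊆V : U ⊆ᴹ V
        U⊆V m u with Equivalence.to (U≡⋃F (just m)) u
        ... | A , A∈F , a = ≤⊥⇒⊆ᴹ (upperV A A∈F) m a

  module _ {F G : Subset M → Set} (F⊑G : ∀ A → F A → ∃ λ B → G B × (A ∼ B))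
           (U≡⋃F : IsUnion F U) (V≡⋃G : IsUnion G V) where

    union-mono-⊆ᴹ : U ⊆ᴹ V
    union-mono-⊆ᴹ m u with Equivalence.to (U≡⋃F (just m)) u
    ... | A , A∈F , a with F⊑G A A∈F
    ...   | B , B∈G , A∼B = Equivalence.from (V≡⋃G (just m)) (B , B∈G , ∼⇒⊆ᴹ A∼B m a)

    -- ⊥ reaches U through some A ∈ F; either its partner B ∈ G keeps ⊥, or A is infinite.
    union-⊥ : nothing ∈ˢ U → nothing ∈ˢ V ⊎ Infinite U
    union-⊥ u with Equivalence.to (U≡⋃F nothing) u
    ... | A , A∈F , a with F⊑G A A∈F
    ...   | B , B∈G , A∼B with A nothing ≟ B nothing
    ...     | yes ⊥≡ = inj₁ (Equivalence.from (V≡⋃G nothing) (B , B∈G , trans (sym ⊥≡) a))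
    ...     | no  ⊥≢ = inj₂ (infinite-mono-⊆ᴹ (λ m a → Equivalence.from (U≡⋃F (just m)) (A , A∈F , a))
                                               (∼-⊥-mismatch⇒infinite A∼B ⊥≢))

  union-resp-SameClasses : ∀ F G U V → SameClasses F G → IsUnion F U → IsUnion G V → U ∼ V
  union-resp-SameClasses F G U V (F⊑G , G⊒F) U≡⋃F V≡⋃G = ≗ᴹ⇒∼ (⊆ᴹ-antisym {U} {V} U⊆V V⊆U) infinite
    where
    G⊑F : ∀ B → G B → ∃ λ A → F A × (B ∼ A)
    G⊑F B B∈G with G⊒F B B∈G
    ... | A , A∈F , A∼B = A , A∈F , ∼-sym A∼B

    U⊆V = union-mono-⊆ᴹ F⊑G U≡⋃F V≡⋃G
    V⊆U = union-mono-⊆ᴹ G⊑F V≡⋃G U≡⋃F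

    infinite : U nothing ≢ V nothing → Infinite U
    infinite ⊥≢ with ≢⇒exactly-one-true ⊥≢
    ... | inj₁ (u , v∉) with union-⊥ F⊑G U≡⋃F V≡⋃G u
    ...   | inj₁ v    = contradiction v v∉
    ...   | inj₂ infU = infU
    infinite ⊥≢ | inj₂ (v , u∉) with union-⊥ G⊑F V≡⋃G U≡⋃F v
    ...   | inj₁ u    = contradiction u u∉
    ...   | inj₂ infV = infinite-mono-⊆ᴹ V⊆U infV

  module _ (em : ExcludedMiddle 0ℓ) where

    ⋃ : (Subset M → Set) → Subset M
    ⋃ F x = does (em {∃ λ A → F A × (x ∈ˢ A)})

    ⋃-isUnion : ∀ F → IsUnion F (⋃ F)
    ⋃-isUnion F x with em {∃ λ A → F A × (x ∈ˢ A)}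
    ... | yes x∈⋃F = mk⇔ (λ _ → x∈⋃F) (λ _ → refl)
    ... | no  x∉⋃F = mk⇔ (λ ()) (λ x∈⋃F → contradiction x∈⋃F x∉⋃F)

    chainComplete : ChainComplete {M}
    chainComplete F chain with em {∃ λ Z → F Z × Final Z}
    ... | yes (Z , Z∈F , finZ) = Z , final-isSup F chain Z∈F finZ
    ... | no noFinal with em {∃ λ A → F A}
    ...   | yes inhabited = ⋃ F , union-isSup F chain inhabited allBot (⋃ F) (⋃-isUnion F)
      where
      allBot : ∀ A → F A → Bot∈ A
      allBot A A∈F with em {Bot∈ A}
      ... | yes ⊥∈A = ⊥∈A
      ... | no  finA = contradiction (A , A∈F , finA) noFinal
    ...   | no empty = BotSet , (λ A A∈F → contradiction (A , A∈F) empty) , (λ U _ → BotSet-minimum U)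

    maximal⇔ : ∀ A → Maximal A ⇔ ((A ∼ MSet) ⊎ Final A)
    maximal⇔ A = mk⇔ toMSetOrFinal fromMSetOrFinal
      where
      toMSetOrFinal : Maximal A → (A ∼ MSet) ⊎ Final A
      toMSetOrFinal maxA with em {Bot∈ A}
      ... | yes ⊥∈A = inj₁ (maxA MSet (inj₂ (⊥∈A , λ m _ → refl)))
      ... | no  finA = inj₂ finA

      fromMSetOrFinal : (A ∼ MSet) ⊎ Final A → Maximal A
      fromMSetOrFinal (inj₂ finA) = final⇒maximal finA
      fromMSetOrFinal (inj₁ A∼M) with em {Bot∈ A}
      ... | yes ⊥∈A = ∼MSet⇒maximal ⊥∈A A∼M
      ... | no  finA = final⇒maximal finA

mainTheorem1 : ExcludedMiddle 0ℓ → (M : Set) →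
    IsPartialOrder (_∼_ {M}) (_≤⊥_ {M})
    × ChainComplete {M}
    × (∀ (A : Subset M) → BotSet ≤⊥ A)
    × (∀ (A : Subset M) → Maximal A ⇔ ((A ∼ MSet) ⊎ Final A))
    × UnionWellDefined {M}
    × (∀ (F : Subset M → Set) → IsChain F → (∃ λ A → F A) →
         (∀ A → F A → Bot∈ A) →
         ∀ U → IsUnion F U → IsSup F U)
    × (∀ (F : Subset M → Set) → IsChain F → ∀ Z → F Z → Final Z →
         IsSup F Z × (∀ Z′ → F Z′ → Final Z′ → Z ∼ Z′))
mainTheorem1 em M =
    ≤⊥-isPartialOrder
  , chainComplete em
  , BotSet-minimum
  , maximal⇔ em
  , ((λ F → ⋃ em F , ⋃-isUnion em F) , union-resp-SameClasses)
  , union-isSup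
  , λ F chain Z Z∈F finZ → final-isSup F chain Z∈F finZ , final-unique F chain Z∈F finZ
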